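{- Let $n\geq k\geq 1$, let $S\neq T$ be $k$-subsets of $[n]$, and let $C$ be a non-trivial component of $h(S,T)$. Then at least one of the following holds: the vertex $x_{max}(C)$ has degree one in $h(S,T)$; the vertex $y_{min}(C)$ has degree one in $h(S,T)$; the pair $(x_{max}(C),y_{min}(C))$ belongs to both $f(S)$ and $f(T)$.
   Context: $[m]=\{1,\dots,m\}$. For a $k$-subset $S$ of $[n]$ define $f(S)\subseteq([n]\setminus[k])\times[k]$: if $S=[k]$ then $f(S)=\emptyset$; otherwise let $S\setminus[k]=\{x_1,\dots,x_t\}$ with $n\geq x_1>\dots>x_t\geq k+1$ and $[k]\setminus S=\{y_1,\dots,y_t\}$ with $1\leq y_1<\dots<y_t\leq k$, and set $f(S)=\{(x_1,y_1),\dots,(x_t,y_t)\}$. Let $h(S)$ be the graph on $[n]$ whose edges are the pairs $\{x,y\}$ with $(x,y)\in f(S)$, and $h(S,T)$ the multigraph union of $h(S)$ and $h(T)$ (pairs in $f(S)\cap f(T)$ give double edges; degrees count multiplicity). A non-trivial component is a connected component with at least one edge. For such $C$ (viewed as its vertex set): $x_{max}(C)=\max(C\cap([n]\setminus[k]))$, $x_{min}(C)=\min(C\cap([n]\setminus[k]))$, $y_{max}(C)=\max(C\cap[k])$, $y_{min}(C)=\min(C\cap[k])$. -}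

module Defs where

open import Data.Bool using (Bool; true; false; not; _∧_; if_then_else_)
open import Data.Nat using (ℕ; zero; suc; _+_; _≡ᵇ_; _<ᵇ_; _≤_; _<_)
open import Data.Fin using (Fin; toℕ)
open import Data.Fin.Subset using (Subset)
open import Data.Vec using (lookup)
open import Data.List using (List; []; _∷_; map; filterᵇ; reverse; zip; allFin; _++_)
open import Data.List.Membership.Propositional using (_∈_)
open import Data.Product using (_×_; _,_; ∃)
open import Data.Sum using (_⊎_)
open import Relation.Binary.Construct.Closure.ReflexiveTransitive using (Star)

-- Convention: a subset S of [n] = {1,…,n} is an element of 'Subset n';
-- the index i : Fin n stands for the number toℕ i + 1 ∈ [n].
-- Vertices of the graphs are the natural numbers 1,…,n.

elem : ∀ {n} → Fin n → ℕ
elem i = suc (toℕ i)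

xsOf : ∀ {n} → ℕ → Subset n → List ℕ
xsOf {n} k S =
  reverse (map elem (filterᵇ (λ i → lookup S i ∧ (k <ᵇ elem i)) (allFin n)))

ysOf : ∀ {n} → ℕ → Subset n → List ℕ
ysOf {n} k S =
  map elem (filterᵇ (λ i → not (lookup S i) ∧ (elem i <ᵇ suc k)) (allFin n))

f : ∀ {n} → ℕ → Subset n → List (ℕ × ℕ)
f k S = zip (xsOf k S) (ysOf k S)

-- Edge multiset of h(S,T): multigraph union of h(S) and h(T).
hST : ∀ {n} → ℕ → Subset n → Subset n → List (ℕ × ℕ)
hST k S T = f k S ++ f k T

deg : List (ℕ × ℕ) → ℕ → ℕ
deg [] v = zero
deg ((x , y) ∷ E) v =
  (if x ≡ᵇ v then 1 else 0) + (if y ≡ᵇ v then 1 else 0) + deg E v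

Adj : List (ℕ × ℕ) → ℕ → ℕ → Set
Adj E u w = ((u , w) ∈ E) ⊎ ((w , u) ∈ E)

Connected : List (ℕ × ℕ) → ℕ → ℕ → Set
Connected E = Star (Adj E)

-- v lies on at least one edge, so its component is non-trivial
NonIsolated : List (ℕ × ℕ) → ℕ → Set
NonIsolated E v = ∃ λ w → Adj E v w

-- The component C of v is {w | Connected E v w}.
-- x_max(C): largest vertex of C in [n] \ [k]
IsXMax : List (ℕ × ℕ) → ℕ → ℕ → ℕ → Set
IsXMax E k v x =
  Connected E v x × k < x × (∀ w → Connected E v w → k < w → w ≤ x)

IsYMin : List (ℕ × ℕ) → ℕ → ℕ → ℕ → Set
IsYMin E k v y =
  Connected E v y × 1 ≤ y × y ≤ k × (∀ w → Connected E v w → 1 ≤ w → w ≤ k → y ≤ w)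

-- Listed as x₁ > ⋯ > x_t against y₁ < ⋯ < y_t, the pairs of f(S) form a matching between
-- [n] ∖ [k] and [k] whose intervals [y, x] are strictly nested. So every vertex has degree at
-- most one in h(S), and x_max(C), which has an edge, has degree one in h(S,T) unless it has
-- an edge (x_max, a) in f(S) and one in f(T); likewise for y_min(C) and an edge (c, y_min).
-- Two edges of f(S) are equal or nested, and nesting would give a < y_min or x_max < c,
-- although a and c lie in C. Hence (x_max, a) = (c, y_min) in f(S), and the same in f(T).
module Submission where

open import Defs
open import Data.Nat using (ℕ; _≤_)
open import Data.Fin.Subset using (Subset; ∣_∣)
open import Data.List.Membership.Propositional using (_∈_)
open import Data.Product using (_×_; _,_)
open import Data.Sum using (_⊎_)
open import Relation.Binary.PropositionalEquality using (_≡_; _≢_)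

open import Level using (Level)
open import Function using (_∘_; flip; _on_)
open import Function.Bundles using (module Equivalence)
open import Data.Bool using (Bool; true; false; T; not; _∧_)
open import Data.Bool.Properties using (T-∧)
open import Data.Nat using (suc; _+_; _<_; _>_; _≡ᵇ_; _<ᵇ_; z≤n; s≤s; s≤s⁻¹)
open import Data.Nat.Properties
  using (_≟_; <ᵇ⇒<; <⇒≢; >⇒≢; <⇒≱; ≤-<-trans; +-assoc)
open import Data.Fin using (Fin)
open import Data.Vec using (lookup)
open import Data.List using (List; []; _∷_; map; reverse; zip; filterᵇ; allFin; _++_)
open import Data.List.Properties using (unfold-reverse)
open import Data.List.Relation.Unary.All as All using (All; []; _∷_)
import Data.List.Relation.Unary.All.Properties as All
open import Data.List.Relation.Unary.Any using (here; there)
import Data.List.Relation.Unary.Any.Properties as Any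
open import Data.List.Relation.Unary.AllPairs as AllPairs using (AllPairs; []; _∷_)
import Data.List.Relation.Unary.AllPairs.Properties as AllPairs
open import Data.List.Membership.Propositional.Properties using (∈-++⁻; ∈-++⁺ˡ; ∈-++⁺ʳ)
open import Data.Product using (proj₁; proj₂; ∃)
open import Data.Sum using (inj₁; inj₂; [_,_])
import Data.Sum as Sum
open import Relation.Binary.Core using (Rel)
open import Relation.Binary.PropositionalEquality using (refl; sym; trans; cong; cong₂)
open import Relation.Binary.Construct.Closure.ReflexiveTransitive using (ε; _◅_; _◅◅_)
open import Relation.Nullary using (¬_; contradiction)
open import Relation.Nullary.Reflects using (Reflects; ofʸ; ofⁿ)
open import Relation.Nullary.Decidable using (proof; T?)

private variable
  a b ℓ ℓ′ : Level
  A B : Set a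

All-reverse⁺ : ∀ {P : A → Set ℓ} {xs} → All P xs → All P (reverse xs)
All-reverse⁺ ps = All.tabulate (All.lookup ps ∘ Any.reverse⁻)

AllPairs-reverse⁺ : ∀ {R : Rel A ℓ} {xs} → AllPairs R xs → AllPairs (flip R) (reverse xs)
AllPairs-reverse⁺ {xs = []} [] = []
AllPairs-reverse⁺ {xs = x ∷ xs} (px ∷ pxs) rewrite unfold-reverse x xs =
  AllPairs.++⁺ (AllPairs-reverse⁺ pxs) ([] ∷ []) (All.map (_∷ []) (All-reverse⁺ px))

zip-All : ∀ {P : A → Set ℓ} {Q : B → Set ℓ′} {xs ys} → All P xs → All Q ys →
          All (λ e → P (proj₁ e) × Q (proj₂ e)) (zip xs ys)
zip-All [] _ = []
zip-All (_ ∷ _) [] = []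
zip-All (px ∷ pxs) (qy ∷ qys) = (px , qy) ∷ zip-All pxs qys

Nested : List (ℕ × ℕ) → Set
Nested = AllPairs λ p q → proj₁ q < proj₁ p × proj₂ p < proj₂ q

Bipartite : ℕ → List (ℕ × ℕ) → Set
Bipartite k = All λ e → k < proj₁ e × 1 ≤ proj₂ e × proj₂ e ≤ k

record NestedMatching (k : ℕ) (L : List (ℕ × ℕ)) : Set where
  field
    nested    : Nested L
    bipartite : Bipartite k L

open NestedMatching

zip-nested : ∀ {xs ys} → AllPairs _>_ xs → AllPairs _<_ ys → Nested (zip xs ys)
zip-nested [] _ = []
zip-nested (_ ∷ _) [] = []
zip-nested (x>xs ∷ xs↓) (y<ys ∷ ys↑) = zip-All x>xs y<ys ∷ zip-nested xs↓ ys↑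

nested-compare : ∀ {L p q} → Nested L → p ∈ L → q ∈ L →
  p ≡ q ⊎ (proj₁ q < proj₁ p × proj₂ p < proj₂ q) ⊎ (proj₁ p < proj₁ q × proj₂ q < proj₂ p)
nested-compare (_ ∷ _) (here refl) (here refl) = inj₁ refl
nested-compare (p<L ∷ _) (here refl) (there q∈L) = inj₂ (inj₁ (All.lookup p<L q∈L))
nested-compare (q<L ∷ _) (there p∈L) (here refl) = inj₂ (inj₂ (All.lookup q<L p∈L))
nested-compare (_ ∷ L-nested) (there p∈L) (there q∈L) = nested-compare L-nested p∈L q∈L

elems-filter-increasing : ∀ {n} (p : Fin n → Bool) →
                          AllPairs _<_ (map elem (filterᵇ p (allFin n)))
elems-filter-increasing p =
  AllPairs.map⁺ (AllPairs.filter⁺ _ (AllPairs.tabulate⁺-< s≤s))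

elems-filter-All : ∀ {n} {P : ℕ → Set} (p : Fin n → Bool) → (∀ i → T (p i) → P (elem i)) →
                   All P (map elem (filterᵇ p (allFin n)))
elems-filter-All {n} p P-elem =
  All.map⁺ (All.map (P-elem _) (All.all-filter (T? ∘ p) (allFin n)))

f-matching : ∀ {n} k (S : Subset n) → NestedMatching k (f k S)
f-matching {n} k S = record
  { nested    = zip-nested (AllPairs-reverse⁺ (elems-filter-increasing x∈S∖[k]))
                           (elems-filter-increasing y∈[k]∖S)
  ; bipartite = zip-All xs-above ys-within
  }
  where
  x∈S∖[k] y∈[k]∖S : Fin n → Bool
  x∈S∖[k] i = lookup S i ∧ (k <ᵇ elem i)
  y∈[k]∖S i = not (lookup S i) ∧ (elem i <ᵇ suc k)

  xs-above : All (k <_) (xsOf k S)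
  xs-above = All-reverse⁺ (elems-filter-All x∈S∖[k] λ i t →
    <ᵇ⇒< k (elem i) (proj₂ (Equivalence.to T-∧ t)))

  ys-within : All (λ y → 1 ≤ y × y ≤ k) (ysOf k S)
  ys-within = elems-filter-All y∈[k]∖S λ i t →
    s≤s z≤n , s≤s⁻¹ (<ᵇ⇒< (elem i) (suc k) (proj₂ (Equivalence.to T-∧ t)))

≡ᵇ-reflects : ∀ m n → Reflects (m ≡ n) (m ≡ᵇ n)
≡ᵇ-reflects m n = proof (m ≟ n)

deg-++ : ∀ E F v → deg (E ++ F) v ≡ deg E v + deg F v
deg-++ [] F v = refl
deg-++ ((x , y) ∷ E) F v rewrite deg-++ E F v = sym (+-assoc _ (deg E v) (deg F v))

DegreeIndicator : List (ℕ × ℕ) → ℕ → Set → Set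
DegreeIndicator E v P = (deg E v ≡ 0 × ¬ P) ⊎ (deg E v ≡ 1 × P)

deg-fst : ∀ {E v} → AllPairs (_≢_ on proj₁) E → All (λ e → proj₂ e ≢ v) E →
          DegreeIndicator E v (∃ λ y → (v , y) ∈ E)
deg-fst [] [] = inj₁ (refl , λ ())
deg-fst {(x , y) ∷ E} {v} (x∉E ∷ E-distinct) (y≢v ∷ E≢v)
  with y ≡ᵇ v | ≡ᵇ-reflects y v | x ≡ᵇ v | ≡ᵇ-reflects x v | deg-fst E-distinct E≢v
... | true  | ofʸ y≡v | _     | _        | _                    = contradiction y≡v y≢v
... | false | _       | true  | ofʸ refl | inj₁ (d≡0 , _)       = inj₂ (cong suc d≡0 , y , here refl)
... | false | _       | true  | ofʸ refl | inj₂ (_ , _ , xz∈E)  =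
  contradiction refl (All.lookup x∉E xz∈E)
... | false | _       | false | ofⁿ x≢v  | inj₁ (d≡0 , ∄z)      =
  inj₁ (d≡0 , λ { (_ , here refl) → x≢v refl ; (z , there vz∈E) → ∄z (z , vz∈E) })
... | false | _       | false | ofⁿ _    | inj₂ (d≡1 , z , vz∈E) = inj₂ (d≡1 , z , there vz∈E)

deg-snd : ∀ {E v} → AllPairs (_≢_ on proj₂) E → All (λ e → proj₁ e ≢ v) E →
          DegreeIndicator E v (∃ λ x → (x , v) ∈ E)
deg-snd [] [] = inj₁ (refl , λ ())
deg-snd {(x , y) ∷ E} {v} (y∉E ∷ E-distinct) (x≢v ∷ E≢v)
  with x ≡ᵇ v | ≡ᵇ-reflects x v | y ≡ᵇ v | ≡ᵇ-reflects y v | deg-snd E-distinct E≢v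
... | true  | ofʸ x≡v | _     | _        | _                    = contradiction x≡v x≢v
... | false | _       | true  | ofʸ refl | inj₁ (d≡0 , _)       = inj₂ (cong suc d≡0 , x , here refl)
... | false | _       | true  | ofʸ refl | inj₂ (_ , _ , zy∈E)  =
  contradiction refl (All.lookup y∉E zy∈E)
... | false | _       | false | ofⁿ y≢v  | inj₁ (d≡0 , ∄z)      =
  inj₁ (d≡0 , λ { (_ , here refl) → y≢v refl ; (z , there zv∈E) → ∄z (z , zv∈E) })
... | false | _       | false | ofⁿ _    | inj₂ (d≡1 , z , zv∈E) = inj₂ (d≡1 , z , there zv∈E)

deg-++-≡1⊎both : ∀ E F {v P Q} → DegreeIndicator E v P → DegreeIndicator F v Q → P ⊎ Q →
                 deg (E ++ F) v ≡ 1 ⊎ (P × Q)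
deg-++-≡1⊎both E F (inj₁ (_ , ¬p)) (inj₁ (_ , ¬q)) p⊎q = contradiction p⊎q [ ¬p , ¬q ]
deg-++-≡1⊎both E F {v} (inj₁ (d≡0 , _)) (inj₂ (d≡1 , _)) _ =
  inj₁ (trans (deg-++ E F v) (cong₂ _+_ d≡0 d≡1))
deg-++-≡1⊎both E F {v} (inj₂ (d≡1 , _)) (inj₁ (d≡0 , _)) _ =
  inj₁ (trans (deg-++ E F v) (cong₂ _+_ d≡1 d≡0))
deg-++-≡1⊎both E F (inj₂ (_ , p)) (inj₂ (_ , q)) _ = inj₂ (p , q)

deg-above : ∀ {k E v} → NestedMatching k E → k < v →
            DegreeIndicator E v (∃ λ y → (v , y) ∈ E)
deg-above M k<v =
  deg-fst (AllPairs.map (>⇒≢ ∘ proj₁) (M .nested))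
          (All.map (λ (_ , _ , y≤k) → <⇒≢ (≤-<-trans y≤k k<v)) (M .bipartite))

deg-below : ∀ {k E v} → NestedMatching k E → v ≤ k →
            DegreeIndicator E v (∃ λ x → (x , v) ∈ E)
deg-below M v≤k =
  deg-snd (AllPairs.map (<⇒≢ ∘ proj₂) (M .nested))
          (All.map (λ (k<x , _) → >⇒≢ (≤-<-trans v≤k k<x)) (M .bipartite))

nonIsolated-connected : ∀ {E v w} → Connected E v w → NonIsolated E v → NonIsolated E w
nonIsolated-connected ε v-edge = v-edge
nonIsolated-connected (inj₁ vu∈E ◅ u~w) _ = nonIsolated-connected u~w (_ , inj₂ vu∈E)
nonIsolated-connected (inj₂ uv∈E ◅ u~w) _ = nonIsolated-connected u~w (_ , inj₁ uv∈E)

nonIsolated-above : ∀ {k E x} → Bipartite k E → k < x → NonIsolated E x →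
                    ∃ λ y → (x , y) ∈ E
nonIsolated-above _ _ (y , inj₁ xy∈E) = y , xy∈E
nonIsolated-above E-bip k<x (_ , inj₂ yx∈E) =
  contradiction (proj₂ (proj₂ (All.lookup E-bip yx∈E))) (<⇒≱ k<x)

nonIsolated-below : ∀ {k E y} → Bipartite k E → y ≤ k → NonIsolated E y →
                    ∃ λ x → (x , y) ∈ E
nonIsolated-below E-bip y≤k (_ , inj₁ yx∈E) =
  contradiction y≤k (<⇒≱ (proj₁ (All.lookup E-bip yx∈E)))
nonIsolated-below _ _ (x , inj₂ xy∈E) = x , xy∈E

∃-∈-++⁻ : ∀ (g : ℕ → ℕ × ℕ) E {F} → (∃ λ z → g z ∈ E ++ F) →
          (∃ λ z → g z ∈ E) ⊎ (∃ λ z → g z ∈ F)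
∃-∈-++⁻ g E (z , gz∈E++F) = Sum.map (z ,_) (z ,_) (∈-++⁻ E gz∈E++F)

above-deg-≡1⊎both : ∀ {k E F x} → NestedMatching k E → NestedMatching k F → k < x →
  NonIsolated (E ++ F) x →
  deg (E ++ F) x ≡ 1 ⊎ ((∃ λ y → (x , y) ∈ E) × (∃ λ y → (x , y) ∈ F))
above-deg-≡1⊎both {E = E} {F} {x} ME MF k<x x-edge =
  deg-++-≡1⊎both E F (deg-above ME k<x) (deg-above MF k<x)
    (∃-∈-++⁻ (x ,_) E (nonIsolated-above (All.++⁺ (ME .bipartite) (MF .bipartite)) k<x x-edge))

below-deg-≡1⊎both : ∀ {k E F y} → NestedMatching k E → NestedMatching k F → y ≤ k →
  NonIsolated (E ++ F) y →
  deg (E ++ F) y ≡ 1 ⊎ ((∃ λ x → (x , y) ∈ E) × (∃ λ x → (x , y) ∈ F))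
below-deg-≡1⊎both {E = E} {F} {y} ME MF y≤k y-edge =
  deg-++-≡1⊎both E F (deg-below ME y≤k) (deg-below MF y≤k)
    (∃-∈-++⁻ (_, y) E (nonIsolated-below (All.++⁺ (ME .bipartite) (MF .bipartite)) y≤k y-edge))

extremes-joined : ∀ {k E L v xm ym a c} → NestedMatching k L → (∀ {e} → e ∈ L → e ∈ E) →
  IsXMax E k v xm → IsYMin E k v ym → (xm , a) ∈ L → (c , ym) ∈ L → (xm , ym) ∈ L
extremes-joined M L⊆E (v~xm , _ , xm-max) (v~ym , _ , _ , ym-min) xa∈L cy∈L
  with nested-compare (M .nested) xa∈L cy∈L
... | inj₁ refl = xa∈L
... | inj₂ (inj₁ (_ , a<ym)) =
  let _ , 1≤a , a≤k = All.lookup (M .bipartite) xa∈L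
  in contradiction (ym-min _ (v~xm ◅◅ inj₁ (L⊆E xa∈L) ◅ ε) 1≤a a≤k) (<⇒≱ a<ym)
... | inj₂ (inj₂ (xm<c , _)) =
  let k<c , _ = All.lookup (M .bipartite) cy∈L
  in contradiction (xm-max _ (v~ym ◅◅ inj₂ (L⊆E cy∈L) ◅ ε) k<c) (<⇒≱ xm<c)

mainTheorem4 : (n k : ℕ) → 1 ≤ k → k ≤ n → (S T : Subset n) → ∣ S ∣ ≡ k → ∣ T ∣ ≡ k → S ≢ T
    → (v : ℕ) → NonIsolated (hST k S T) v
    → (xm ym : ℕ) → IsXMax (hST k S T) k v xm → IsYMin (hST k S T) k v ym
    → deg (hST k S T) xm ≡ 1 ⊎ deg (hST k S T) ym ≡ 1 ⊎ ((xm , ym) ∈ f k S × (xm , ym) ∈ f k T)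
mainTheorem4 n k _ _ S T _ _ _ v v-edge xm ym
             xm-max@(v~xm , k<xm , _) ym-min@(v~ym , _ , ym≤k , _)
  with above-deg-≡1⊎both (f-matching k S) (f-matching k T) k<xm
                         (nonIsolated-connected v~xm v-edge)
     | below-deg-≡1⊎both (f-matching k S) (f-matching k T) ym≤k
                         (nonIsolated-connected v~ym v-edge)
... | inj₁ deg-xm≡1 | _ = inj₁ deg-xm≡1
... | inj₂ _ | inj₁ deg-ym≡1 = inj₂ (inj₁ deg-ym≡1)
... | inj₂ ((_ , xa∈S) , (_ , xb∈T)) | inj₂ ((_ , cy∈S) , (_ , dy∈T)) =
  inj₂ (inj₂ ( extremes-joined (f-matching k S) ∈-++⁺ˡ xm-max ym-min xa∈S cy∈S
             , extremes-joined (f-matching k T) (∈-++⁺ʳ (f k S)) xm-max ym-min xb∈T dy∈T))
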